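{- For $n\geq 4$, let $S_n$ be the star with $n$ vertices (one center adjacent to $n-1$ leaves). Then $\chi_L(S_n\odot\overline{K_1})=\lceil\sqrt{n}\rceil+1$.
   Context: All graphs are finite and simple. For a connected graph $G$, a $k$-coloring is a map $c:V(G)\to\{1,\ldots,k\}$ with $c(u)\neq c(v)$ whenever $uv\in E(G)$; it induces the partition $\Pi=\{C_1,\ldots,C_k\}$ into color classes. The color code of $v$ is $c_\Pi(v)=(d(v,C_1),\ldots,d(v,C_k))$, where $d(v,C_i)=\min\{d(v,x): x\in C_i\}$. The coloring is locating if distinct vertices have distinct color codes; $\chi_L(G)$ is the least $k$ admitting a locating $k$-coloring. The corona product $G\odot H$ (for $V(G)=\{a_1,\ldots,a_n\}$) is obtained from one copy of $G$ and $n$ copies of $H$ by joining $a_i$ to every vertex of the $i$-th copy of $H$; thus $S_n\odot\overline{K_1}$ is obtained from $S_n$ by attaching one pendant vertex to each vertex. -}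

module Defs where

open import Data.Nat using (ℕ; zero; suc; _≤_; _<_; _*_)
open import Data.Fin using (Fin; zero)
open import Data.Bool using (Bool; true; false)
open import Data.Product using (Σ; ∃; ∃-syntax; _×_; _,_)
open import Data.Sum using (_⊎_)
open import Relation.Binary.PropositionalEquality using (_≡_; _≢_)
open import Relation.Nullary using (¬_)

record Graph : Set₁ where
  field
    V   : Set
    Adj : V → V → Set
open Graph public

data Walk (G : Graph) : V G → V G → ℕ → Set where
  nil  : ∀ {u} → Walk G u u zero
  cons : ∀ {u w v k} → Adj G u w → Walk G w v k → Walk G u v (suc k)

Dist : (G : Graph) → V G → V G → ℕ → Set
Dist G u v k = Walk G u v k × (∀ m → m < k → ¬ Walk G u v m)

Connected : Graph → Set
Connected G = ∀ u v → ∃[ k ] Walk G u v k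

-- proper k-coloring (every color class nonempty, so it induces a partition
-- into k color classes C_1 … C_k)
record Coloring (G : Graph) (k : ℕ) : Set where
  field
    col    : V G → Fin k
    proper : ∀ u v → Adj G u v → col u ≢ col v
    onto   : ∀ i → ∃[ x ] col x ≡ i
open Coloring public

ClassDist : (G : Graph) {k : ℕ} → Coloring G k → V G → Fin k → ℕ → Set
ClassDist G c v i d =
  (∃[ x ] (col c x ≡ i × Walk G v x d)) ×
  (∀ m → m < d → ¬ (∃[ x ] (col c x ≡ i × Walk G v x m)))

Locating : (G : Graph) {k : ℕ} → Coloring G k → Set
Locating G {k} c = ∀ u v → u ≢ v →
  ∃[ i ] ∃[ a ] ∃[ b ] (ClassDist G c u i a × ClassDist G c v i b × a ≢ b)

HasLocatingColoring : Graph → ℕ → Set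
HasLocatingColoring G k = Σ (Coloring G k) (Locating G)

LocChromNum : Graph → ℕ → Set
LocChromNum G m = HasLocatingColoring G m × (∀ k → k < m → ¬ HasLocatingColoring G k)

CeilSqrt : ℕ → ℕ → Set
CeilSqrt n s = n ≤ s * s × (∀ t → n ≤ t * t → s ≤ t)

-- Star S_n on vertices Fin n, center = zero, leaves = the others.
-- (for n = 0 the star is empty, so no adjacencies)
data StarAdj : (n : ℕ) → Fin n → Fin n → Set where
  center-leaf : ∀ {n j} → j ≢ zero → StarAdj (suc n) zero j
  leaf-center : ∀ {n i} → i ≢ zero → StarAdj (suc n) i zero

-- Corona S_n ⊙ K̄₁ : vertex (i , false) is star vertex a_i,
-- vertex (i , true) is the pendant vertex attached to a_i.
data CoronaAdj {n : ℕ} : Fin n × Bool → Fin n × Bool → Set where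
  star     : ∀ {i j} → StarAdj n i j → CoronaAdj (i , false) (j , false)
  to-pend  : ∀ {i} → CoronaAdj (i , false) (i , true)
  from-pend : ∀ {i} → CoronaAdj (i , true) (i , false)

StarCorona : ℕ → Graph
StarCorona n = record { V = Fin n × Bool ; Adj = CoronaAdj {n} }

-- Index the vertices of S_n ⊙ K̄₁ so that vertex i of the star has an "inner" vertex adjacent to
-- the centre and an "outer" vertex adjacent to the inner one.  A proper colouring is then locating
-- exactly when the pairs (c(inner i), c(outer i)) are pairwise distinct: if two indices have the
-- same pair, colour-preserving homomorphisms map their inner vertices onto each other, so these
-- share their colour code; if all pairs differ, of two equally coloured vertices one always has a
-- neighbour whose colour occurs at no neighbour of the other.  With k colours there are at most
-- (k - 1)² admissible pairs (the inner colour avoids the centre's, the outer one avoids the inner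
-- one), and for n ≤ s² the s² pairs with centre colour 0 can be realised using all s + 1 colours.
module Submission where

open import Data.Bool as Bool using (Bool; true; false)
open import Data.Empty using (⊥-elim)
open import Data.Fin as Fin using (Fin; zero; suc; toℕ; combine; remQuot; punchIn; punchOut; inject≤)
import Data.Fin.Properties as Finₚ
open import Data.Nat using (ℕ; zero; suc; _≤_; _<_; _+_; _*_; s≤s)
import Data.Nat.Properties as ℕₚ
open import Data.Product using (∃; ∃-syntax; _×_; _,_; proj₁; proj₂; uncurry)
open import Data.Product.Properties using (≡-dec)
open import Data.Sum as Sum using (_⊎_; inj₁; inj₂)
open import Function using (_∘_; id)
open import Relation.Binary.Definitions using (DecidableEquality)
open import Relation.Binary.PropositionalEquality
open import Relation.Nullary using (¬_; Dec; yes; no)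
open import Relation.Nullary.Decidable using (map′; _×-dec_; _⊎-dec_)

open import Defs

least : ∀ {P : ℕ → Set} → (∀ m → Dec (P m)) → ∀ {d} → P d →
        ∃[ m ] (P m × (∀ j → j < m → ¬ P j))
least {P} P? {d} p = Sum.[ (λ none → ⊥-elim (none d ℕₚ.≤-refl p)) , id ] (search (suc d))
  where
  search : ∀ d → (∀ j → j < d → ¬ P j) ⊎ ∃[ m ] (P m × (∀ j → j < m → ¬ P j))
  search zero = inj₁ λ _ ()
  search (suc d) with search d | P? d
  ... | inj₂ found | _     = inj₂ found
  ... | inj₁ none  | yes p = inj₂ (d , p , none)
  ... | inj₁ none  | no ¬p =
    inj₁ λ j j<1+d → Sum.[ none j , (λ { refl → ¬p }) ] (ℕₚ.m<1+n⇒m<n∨m≡n j<1+d)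

module _ {G : Graph} where

  walk-++ : ∀ {u v w a b} → Walk G u v a → Walk G v w b → Walk G u w (a + b)
  walk-++ nil         q = q
  walk-++ (cons uv p) q = cons uv (walk-++ p q)

  walk-map : ∀ {f : V G → V G} → (∀ {x y} → Adj G x y → Adj G (f x) (f y)) →
             ∀ {u v m} → Walk G u v m → Walk G (f u) (f v) m
  walk-map hom nil         = nil
  walk-map hom (cons uv p) = cons (hom uv) (walk-map hom p)

module ColourCodes {G : Graph} {k : ℕ} (c : Coloring G k) where

  classDist-self : ∀ {v i} → col c v ≡ i → ClassDist G c v i 0
  classDist-self {v} v∈i = (v , v∈i , nil) , λ _ ()

  classDist-neighbour : ∀ {v w i} → col c v ≢ i → Adj G v w → col c w ≡ i →
                        ClassDist G c v i 1
  classDist-neighbour v∉i vw w∈i =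
    (_ , w∈i , cons vw nil) , λ { zero _ (_ , v∈i , nil) → v∉i v∈i ; (suc _) (s≤s ()) _ }

  classDist≢0 : ∀ {v i d} → col c v ≢ i → ClassDist G c v i d → d ≢ 0
  classDist≢0 v∉i ((_ , v∈i , nil) , _) refl = v∉i v∈i

  classDist≢1 : ∀ {v i d} → (∀ w → Adj G v w → col c w ≢ i) → ClassDist G c v i d → d ≢ 1
  classDist≢1 noNeighbour ((w , w∈i , cons vw nil) , _) refl = noNeighbour w vw w∈i

  CodesDiffer : V G → V G → Set
  CodesDiffer u v = ∃[ i ] ∃[ a ] ∃[ b ] (ClassDist G c u i a × ClassDist G c v i b × a ≢ b)

  codesDiffer-sym : ∀ {u v} → CodesDiffer u v → CodesDiffer v u
  codesDiffer-sym (i , a , b , du , dv , a≢b) = i , b , a , dv , du , a≢b ∘ sym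

  module _ (classDist : ∀ v i → ∃ (ClassDist G c v i)) where

    codesDiffer-byColour : ∀ {u v} → col c u ≢ col c v → CodesDiffer u v
    codesDiffer-byColour {u} {v} u≢v =
      let (b , dv) = classDist v (col c u)
      in col c u , 0 , b , classDist-self refl , dv , λ 0≡b → classDist≢0 (u≢v ∘ sym) dv (sym 0≡b)

    codesDiffer-byNeighbour : ∀ {u v w} → Adj G u w →
                              (∀ w′ → Adj G v w′ → col c w′ ≢ col c w) → CodesDiffer u v
    codesDiffer-byNeighbour {u} {v} {w} uw noNeighbour =
      let (b , dv) = classDist v (col c w)
      in col c w , 1 , b , classDist-neighbour (proper c u w uw) uw refl , dv ,
         λ 1≡b → classDist≢1 noNeighbour dv (sym 1≡b)

  ColourHom : (V G → V G) → Set
  ColourHom f = (∀ {x y} → Adj G x y → Adj G (f x) (f y)) × (∀ x → col c (f x) ≡ col c x)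

  classDist-hom : ∀ {f u v i a b} → ColourHom f → f u ≡ v →
                  ClassDist G c u i a → ClassDist G c v i b → b ≤ a
  classDist-hom {f} (hom , colour) refl ((x , x∈i , p) , _) (_ , minimal) =
    ℕₚ.≮⇒≥ λ a<b → minimal _ a<b (f x , trans (colour x) x∈i , walk-map hom p)

  ¬codesDiffer-hom : ∀ {f g u v} → ColourHom f → ColourHom g → f u ≡ v → g v ≡ u →
                     ¬ CodesDiffer u v
  ¬codesDiffer-hom hf hg fu≡v gv≡u (_ , _ , _ , du , dv , a≢b) =
    a≢b (ℕₚ.≤-antisym (classDist-hom hg gv≡u dv du) (classDist-hom hf fu≡v du dv))

Searchable : Set → Set₁
Searchable A = ∀ {P : A → Set} → (∀ x → Dec (P x)) → Dec (∃ P)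

module _ (G : Graph) (_≟_ : DecidableEquality (V G)) (adj? : ∀ u v → Dec (Adj G u v))
         (search : Searchable (V G)) where

  walk? : ∀ m u v → Dec (Walk G u v m)
  walk? zero    u v = map′ (λ { refl → nil }) (λ { nil → refl }) (u ≟ v)
  walk? (suc m) u v =
    map′ (λ (_ , uw , p) → cons uw p) (λ { (cons uw p) → _ , uw , p })
         (search λ w → adj? u w ×-dec walk? m w v)

  classDist-exists : Connected G → ∀ {k} (c : Coloring G k) v i → ∃ (ClassDist G c v i)
  classDist-exists connected c v i =
    let (x , x∈i) = onto c i
        (_ , p)   = connected v x
    in least (λ m → search λ x → (col c x Fin.≟ i) ×-dec walk? m v x) (x , x∈i , p)

module _ {n : ℕ} where

  private
    Vertex : Set
    Vertex = Fin (suc n) × Bool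

  -- inner i is the neighbour of the centre indexed by i (the centre's pendant for i = 0) and
  -- outer i the other neighbour of inner i (the centre itself for i = 0).
  centre : Vertex
  centre = zero , false

  inner outer : Fin (suc n) → Vertex
  inner zero    = zero , true
  inner (suc j) = suc j , false
  outer zero    = zero , false
  outer (suc j) = suc j , true

  centre-inner : ∀ i → CoronaAdj centre (inner i)
  centre-inner zero    = to-pend
  centre-inner (suc j) = star (center-leaf λ ())

  inner-outer : ∀ i → CoronaAdj (inner i) (outer i)
  inner-outer zero    = from-pend
  inner-outer (suc j) = to-pend

  inner-neighbours : ∀ i {w} → CoronaAdj (inner i) w → w ≡ centre ⊎ w ≡ outer i
  inner-neighbours zero    from-pend                = inj₁ refl
  inner-neighbours (suc j) (star (leaf-center _)) = inj₁ refl
  inner-neighbours (suc j) to-pend                = inj₂ refl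

  coronaAdj-sym : ∀ {u v : Vertex} → CoronaAdj u v → CoronaAdj v u
  coronaAdj-sym (star (center-leaf j≢0)) = star (leaf-center j≢0)
  coronaAdj-sym (star (leaf-center i≢0)) = star (center-leaf i≢0)
  coronaAdj-sym to-pend                  = from-pend
  coronaAdj-sym from-pend                = to-pend

  toCentre : ∀ v → ∃[ m ] Walk (StarCorona (suc n)) v centre m
  toCentre (zero  , false) = _ , nil
  toCentre (zero  , true)  = _ , cons from-pend nil
  toCentre (suc _ , false) = _ , cons (star (leaf-center λ ())) nil
  toCentre (suc _ , true)  = _ , cons from-pend (cons (star (leaf-center λ ())) nil)

  fromCentre : ∀ v → ∃[ m ] Walk (StarCorona (suc n)) centre v m
  fromCentre (zero  , false) = _ , nil
  fromCentre (zero  , true)  = _ , cons to-pend nil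
  fromCentre (suc _ , false) = _ , cons (star (center-leaf λ ())) nil
  fromCentre (suc _ , true)  = _ , cons (star (center-leaf λ ())) (cons to-pend nil)

  starCorona-connected : Connected (StarCorona (suc n))
  starCorona-connected u v =
    let (a , p) = toCentre u
        (b , q) = fromCentre v
    in a + b , walk-++ p q

starAdj? : ∀ {n} (i j : Fin n) → Dec (StarAdj n i j)
starAdj? zero    zero    = no λ { (center-leaf 0≢0) → 0≢0 refl ; (leaf-center 0≢0) → 0≢0 refl }
starAdj? zero    (suc _) = yes (center-leaf λ ())
starAdj? (suc _) zero    = yes (leaf-center λ ())
starAdj? (suc _) (suc _) = no λ ()

coronaAdj? : ∀ {n} (u v : Fin n × Bool) → Dec (CoronaAdj u v)
coronaAdj? (i , false) (j , false) = map′ star (λ { (star s) → s }) (starAdj? i j)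
coronaAdj? (i , false) (j , true)  = map′ (λ { refl → to-pend }) (λ { to-pend → refl }) (i Fin.≟ j)
coronaAdj? (i , true)  (j , false) = map′ (λ { refl → from-pend }) (λ { from-pend → refl }) (i Fin.≟ j)
coronaAdj? (i , true)  (j , true)  = no λ ()

vertex-search : ∀ {n} → Searchable (Fin n × Bool)
vertex-search P? =
  map′ (λ (i , p) → Sum.[ (λ q → (i , false) , q) , (λ q → (i , true) , q) ] p)
       (λ { ((i , false) , q) → i , inj₁ q ; ((i , true) , q) → i , inj₂ q })
       (Finₚ.any? λ i → P? (i , false) ⊎-dec P? (i , true))

starCorona-classDist : ∀ {n k} (c : Coloring (StarCorona (suc n)) k) v i →
                       ∃ (ClassDist (StarCorona (suc n)) c v i)
starCorona-classDist =
  classDist-exists _ (≡-dec Fin._≟_ Bool._≟_) coronaAdj? vertex-search starCorona-connected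

PairsInjective : ∀ {n k} → Coloring (StarCorona (suc n)) k → Set
PairsInjective c = ∀ i j → col c (inner i) ≡ col c (inner j) → col c (outer i) ≡ col c (outer j) →
                   i ≡ j

module _ {n k : ℕ} (c : Coloring (StarCorona (suc n)) k) where

  open ColourCodes c

  private
    Vertex : Set
    Vertex = Fin (suc n) × Bool

  Separates : Vertex → Vertex → Set
  Separates u v = ∃[ w ] (CoronaAdj u w × (∀ w′ → CoronaAdj v w′ → col c w′ ≢ col c w))

  inner-separates-pendant : ∀ i j → Separates (inner i) (suc j , true)
  inner-separates-pendant i j =
    centre , coronaAdj-sym (centre-inner i) ,
    λ { _ from-pend → proper c _ _ (centre-inner (suc j)) ∘ sym }

  module _ (pairsInjective : PairsInjective c) where

    outer-separates-pendant : ∀ i j → i ≢ suc j → col c (outer i) ≡ col c (outer (suc j)) →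
                              Separates (outer i) (suc j , true)
    outer-separates-pendant i j i≢j outers≡ =
      inner i , coronaAdj-sym (inner-outer i) ,
      λ { _ from-pend inners≡ → i≢j (pairsInjective i (suc j) (sym inners≡) outers≡) }

    leaf-separates-inner : ∀ j i → col c (outer (suc j)) ≢ col c centre →
                           col c (outer (suc j)) ≢ col c (outer i) → Separates (suc j , false) (inner i)
    leaf-separates-inner j i outer≢centre outers≢ =
      outer (suc j) , to-pend ,
      λ w′ iw′ → Sum.[ (λ { refl → outer≢centre ∘ sym }) , (λ { refl → outers≢ ∘ sym }) ]
                      (inner-neighbours i iw′)

    leaf-outer≢centre : ∀ j → col c (inner zero) ≡ col c (inner (suc j)) →
                        col c (outer (suc j)) ≢ col c centre
    leaf-outer≢centre j inners≡ outers≡ with () ← pairsInjective zero (suc j) inners≡ (sym outers≡)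

    -- The two outer colours differ, so at most one of them is the centre's.
    leaves-separation : ∀ j j′ → suc j ≢ suc j′ → col c (inner (suc j)) ≡ col c (inner (suc j′)) →
                        Separates (suc j , false) (suc j′ , false) ⊎
                        Separates (suc j′ , false) (suc j , false)
    leaves-separation j j′ j≢j′ inners≡ with col c (outer (suc j)) Fin.≟ col c centre
    ... | no outer≢centre =
      inj₁ (leaf-separates-inner j (suc j′) outer≢centre (j≢j′ ∘ pairsInjective _ _ inners≡))
    ... | yes outer≡centre =
      inj₂ (leaf-separates-inner j′ (suc j)
              (λ outer′≡centre → j≢j′ (pairsInjective _ _ inners≡ (trans outer≡centre (sym outer′≡centre))))
              (j≢j′ ∘ pairsInjective _ _ inners≡ ∘ sym))

    separation : ∀ u v → u ≢ v → col c u ≡ col c v → Separates u v ⊎ Separates v u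
    separation (zero , false) (zero , false) u≢v _ = ⊥-elim (u≢v refl)
    separation (zero , true)  (zero , true)  u≢v _ = ⊥-elim (u≢v refl)
    separation (zero , false) (zero , true)  _ u≡v = ⊥-elim (proper c _ _ to-pend u≡v)
    separation (zero , true)  (zero , false) _ u≡v = ⊥-elim (proper c _ _ from-pend u≡v)
    separation (zero , false) (suc j , false) _ u≡v = ⊥-elim (proper c _ _ (centre-inner (suc j)) u≡v)
    separation (suc j , false) (zero , false) _ u≡v =
      ⊥-elim (proper c _ _ (coronaAdj-sym (centre-inner (suc j))) u≡v)
    separation (zero , false) (suc j , true) _ u≡v =
      inj₁ (outer-separates-pendant zero j (λ ()) u≡v)
    separation (suc j , true) (zero , false) _ u≡v =
      inj₂ (outer-separates-pendant zero j (λ ()) (sym u≡v))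
    separation (suc j , true) (suc j′ , true) u≢v u≡v =
      inj₁ (outer-separates-pendant (suc j) j′ (u≢v ∘ cong (_, true)) u≡v)
    separation (zero , true)   (suc j , true)   _ _ = inj₁ (inner-separates-pendant zero j)
    separation (suc j , true)  (zero , true)    _ _ = inj₂ (inner-separates-pendant zero j)
    separation (suc j , false) (suc j′ , true)  _ _ = inj₁ (inner-separates-pendant (suc j) j′)
    separation (suc j , true)  (suc j′ , false) _ _ = inj₂ (inner-separates-pendant (suc j′) j)
    separation (zero , true) (suc j , false) _ u≡v =
      inj₂ (leaf-separates-inner j zero (leaf-outer≢centre j u≡v) (leaf-outer≢centre j u≡v))
    separation (suc j , false) (zero , true) _ u≡v =
      inj₁ (leaf-separates-inner j zero (leaf-outer≢centre j (sym u≡v)) (leaf-outer≢centre j (sym u≡v)))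
    separation (suc j , false) (suc j′ , false) u≢v u≡v =
      leaves-separation j j′ (u≢v ∘ cong (_, false)) u≡v

    pairsInjective⇒locating : Locating (StarCorona (suc n)) c
    pairsInjective⇒locating u v u≢v with col c u Fin.≟ col c v
    ... | no colours≢ = codesDiffer-byColour (starCorona-classDist c) colours≢
    ... | yes colours≡ =
      Sum.[ bySeparation , codesDiffer-sym ∘ bySeparation ] (separation u v u≢v colours≡)
      where
      bySeparation : ∀ {x y} → Separates x y → CodesDiffer x y
      bySeparation (_ , xw , noNeighbour) =
        codesDiffer-byNeighbour (starCorona-classDist c) xw noNeighbour

  relocateLeaf : Fin (suc n) → Vertex → Vertex → Vertex → Vertex
  relocateLeaf l p q (i , false) with i Fin.≟ l
  ... | yes _ = p
  ... | no _  = i , false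
  relocateLeaf l p q (i , true) with i Fin.≟ l
  ... | yes _ = q
  ... | no _  = i , true

  relocateLeaf-here : ∀ l p q → relocateLeaf l p q (l , false) ≡ p
  relocateLeaf-here l p q with l Fin.≟ l
  ... | yes _   = refl
  ... | no l≢l = ⊥-elim (l≢l refl)

  relocateLeaf-hom : ∀ {l p q} → l ≢ zero → CoronaAdj centre p → CoronaAdj p q →
                     col c p ≡ col c (l , false) → col c q ≡ col c (l , true) →
                     ColourHom (relocateLeaf l p q)
  relocateLeaf-hom {l} {p} {q} l≢0 centre-p p-q p≈ q≈ = adj , colour
    where
    adj : ∀ {x y} → CoronaAdj x y → CoronaAdj (relocateLeaf l p q x) (relocateLeaf l p q y)
    adj {zero , false} {j , false} (star (center-leaf j≢0)) with zero Fin.≟ l | j Fin.≟ l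
    ... | yes 0≡l | _     = ⊥-elim (l≢0 (sym 0≡l))
    ... | no _    | yes _ = centre-p
    ... | no _    | no _  = star (center-leaf j≢0)
    adj {j , false} {zero , false} (star (leaf-center j≢0)) with j Fin.≟ l | zero Fin.≟ l
    ... | _     | yes 0≡l = ⊥-elim (l≢0 (sym 0≡l))
    ... | yes _ | no _    = coronaAdj-sym centre-p
    ... | no _  | no _    = star (leaf-center j≢0)
    adj {i , false} to-pend with i Fin.≟ l
    ... | yes _ = p-q
    ... | no _  = to-pend
    adj {i , true} from-pend with i Fin.≟ l
    ... | yes _ = coronaAdj-sym p-q
    ... | no _  = from-pend
    colour : ∀ x → col c (relocateLeaf l p q x) ≡ col c x
    colour (i , false) with i Fin.≟ l
    ... | yes refl = p≈
    ... | no _     = refl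
    colour (i , true) with i Fin.≟ l
    ... | yes refl = q≈
    ... | no _     = refl

  relocatePendant : Vertex → Vertex → Vertex
  relocatePendant p (zero  , true)  = p
  relocatePendant p (zero  , false) = zero , false
  relocatePendant p (suc i , b)     = suc i , b

  relocatePendant-hom : ∀ {p} → CoronaAdj centre p → col c p ≡ col c (zero , true) →
                        ColourHom (relocatePendant p)
  relocatePendant-hom {p} centre-p p≈ = adj , colour
    where
    adj : ∀ {x y} → CoronaAdj x y → CoronaAdj (relocatePendant p x) (relocatePendant p y)
    adj {zero  , false} {zero  , false} (star (center-leaf 0≢0)) = ⊥-elim (0≢0 refl)
    adj {zero  , false} {zero  , false} (star (leaf-center 0≢0)) = ⊥-elim (0≢0 refl)
    adj {zero  , false} {suc _ , false} (star s) = star s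
    adj {suc _ , false} {zero  , false} (star s) = star s
    adj {suc _ , false} {suc _ , false} (star ())
    adj {zero  , false} to-pend   = centre-p
    adj {suc _ , false} to-pend   = to-pend
    adj {zero  , true}  from-pend = coronaAdj-sym centre-p
    adj {suc _ , true}  from-pend = from-pend
    colour : ∀ x → col c (relocatePendant p x) ≡ col c x
    colour (zero  , true)  = p≈
    colour (zero  , false) = refl
    colour (suc _ , _)     = refl

  locating⇒pairsInjective : Locating (StarCorona (suc n)) c → PairsInjective c
  locating⇒pairsInjective loc = pairsInjective
    where
    pendant-leaf : ∀ j → col c (inner zero) ≡ col c (inner (suc j)) →
                   col c (outer zero) ≡ col c (outer (suc j)) → zero ≡ suc j
    pendant-leaf j inners≡ outers≡ = ⊥-elim
      (¬codesDiffer-hom (relocatePendant-hom (centre-inner (suc j)) (sym inners≡))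
                        (relocateLeaf-hom (λ ()) to-pend from-pend inners≡ outers≡)
                        refl (relocateLeaf-here (suc j) (zero , true) (zero , false))
                        (loc (zero , true) (suc j , false) λ ()))
    pairsInjective : PairsInjective c
    pairsInjective zero    zero    _ _ = refl
    pairsInjective zero    (suc j) inners≡ outers≡ = pendant-leaf j inners≡ outers≡
    pairsInjective (suc j) zero    inners≡ outers≡ = sym (pendant-leaf j (sym inners≡) (sym outers≡))
    pairsInjective (suc j) (suc j′) inners≡ outers≡ with j Fin.≟ j′
    ... | yes refl = refl
    ... | no j≢j′ = ⊥-elim
      (¬codesDiffer-hom (relocateLeaf-hom (λ ()) (centre-inner (suc j′)) to-pend (sym inners≡) (sym outers≡))
                        (relocateLeaf-hom (λ ()) (centre-inner (suc j)) to-pend inners≡ outers≡)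
                        (relocateLeaf-here (suc j) (suc j′ , false) (suc j′ , true))
                        (relocateLeaf-here (suc j′) (suc j , false) (suc j , true))
                        (loc (suc j , false) (suc j′ , false) (j≢j′ ∘ Finₚ.suc-injective ∘ cong proj₁)))

pairCode : ∀ {k} {c₀ a b : Fin (suc k)} → c₀ ≢ a → a ≢ b → Fin (k * k)
pairCode c₀≢a a≢b = combine (punchOut c₀≢a) (punchOut a≢b)

pairCode-injective : ∀ {k} {c₀ a b a′ b′ : Fin (suc k)}
                     (c₀≢a : c₀ ≢ a) (a≢b : a ≢ b) (c₀≢a′ : c₀ ≢ a′) (a′≢b′ : a′ ≢ b′) →
                     pairCode c₀≢a a≢b ≡ pairCode c₀≢a′ a′≢b′ → a ≡ a′ × b ≡ b′
pairCode-injective c₀≢a a≢b c₀≢a′ a′≢b′ codes≡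
  with firsts≡ , seconds≡ ← Finₚ.combine-injective _ _ _ _ codes≡
  with refl ← Finₚ.punchOut-injective c₀≢a c₀≢a′ firsts≡
  = refl , Finₚ.punchOut-injective a≢b a′≢b′ seconds≡

pairsInjective⇒bound : ∀ {n k} (c : Coloring (StarCorona (suc n)) (suc k)) → PairsInjective c →
                       suc n ≤ k * k
pairsInjective⇒bound c pairsInjective = Finₚ.injective⇒≤ code-injective
  where
  centre≢inner : ∀ i → col c centre ≢ col c (inner i)
  centre≢inner i = proper c _ _ (centre-inner i)
  inner≢outer : ∀ i → col c (inner i) ≢ col c (outer i)
  inner≢outer i = proper c _ _ (inner-outer i)
  code : Fin _ → Fin _
  code i = pairCode (centre≢inner i) (inner≢outer i)
  code-injective : ∀ {i j} → code i ≡ code j → i ≡ j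
  code-injective {i} {j} codes≡ = uncurry (pairsInjective i j)
    (pairCode-injective (centre≢inner i) (inner≢outer i) (centre≢inner j) (inner≢outer j) codes≡)

pairColours : ∀ {s} → Fin s × Fin s → Fin (suc s) × Fin (suc s)
pairColours (q , r) = suc q , punchIn (suc q) r

pairColours-injective : ∀ {s} {x y : Fin s × Fin s} → pairColours x ≡ pairColours y → x ≡ y
pairColours-injective {x = q , r} {q′ , r′} colours≡
  with refl ← Finₚ.suc-injective (cong proj₁ colours≡)
  = cong (q ,_) (Finₚ.punchIn-injective (suc q) r r′ (cong proj₂ colours≡))

module Construction {n t : ℕ} (n≤s² : suc n ≤ suc t * suc t) (s≤n : suc t ≤ suc n) where

  code : Fin (suc n) → Fin (suc t) × Fin (suc t)
  code i = remQuot (suc t) (inject≤ i n≤s²)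

  code-injective : ∀ {i j} → code i ≡ code j → i ≡ j
  code-injective {i} {j} codes≡ = Finₚ.inject≤-injective _ _ i j (begin
    inject≤ i _              ≡⟨ Finₚ.combine-remQuot (suc t) _ ⟨
    uncurry combine (code i) ≡⟨ cong (uncurry combine) codes≡ ⟩
    uncurry combine (code j) ≡⟨ Finₚ.combine-remQuot (suc t) _ ⟩
    inject≤ j _              ∎)
    where open ≡-Reasoning

  code-small : ∀ r → code (inject≤ r s≤n) ≡ (zero , r)
  code-small r = begin
    remQuot (suc t) (inject≤ (inject≤ r s≤n) n≤s²) ≡⟨ cong (remQuot (suc t)) (Finₚ.toℕ-injective toℕ≡) ⟩
    remQuot (suc t) (combine {suc t} zero r)       ≡⟨ Finₚ.remQuot-combine {suc t} zero r ⟩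
    zero , r                                       ∎
    where
    open ≡-Reasoning
    toℕ≡ : toℕ (inject≤ (inject≤ r s≤n) n≤s²) ≡ toℕ (combine {suc t} zero r)
    toℕ≡ = trans (Finₚ.toℕ-inject≤ _ _) (trans (Finₚ.toℕ-inject≤ r _) (sym (Finₚ.toℕ-↑ˡ r _)))

  colour : Fin (suc n) × Bool → Fin (suc (suc t))
  colour (zero  , false) = proj₂ (pairColours (code zero))
  colour (zero  , true)  = proj₁ (pairColours (code zero))
  colour (suc j , false) = proj₁ (pairColours (code (suc j)))
  colour (suc j , true)  = proj₂ (pairColours (code (suc j)))

  colour-pair : ∀ i → (colour (inner i) , colour (outer i)) ≡ pairColours (code i)
  colour-pair zero    = refl
  colour-pair (suc j) = refl

  -- code zero computes to (zero , zero): the centre has colour zero, every inner vertex a successor.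
  colour-proper : ∀ {u v} → CoronaAdj u v → colour u ≢ colour v
  colour-proper (star (center-leaf {j = zero} 0≢0)) = ⊥-elim (0≢0 refl)
  colour-proper (star (center-leaf {j = suc _} _))  = λ ()
  colour-proper (star (leaf-center {i = zero} 0≢0)) = ⊥-elim (0≢0 refl)
  colour-proper (star (leaf-center {i = suc _} _))  = λ ()
  colour-proper {zero  , false} to-pend   = Finₚ.punchInᵢ≢i _ _
  colour-proper {suc _ , false} to-pend   = Finₚ.punchInᵢ≢i _ _ ∘ sym
  colour-proper {zero  , true}  from-pend = Finₚ.punchInᵢ≢i _ _ ∘ sym
  colour-proper {suc _ , true}  from-pend = Finₚ.punchInᵢ≢i _ _

  colour-onto : ∀ x → ∃[ v ] colour v ≡ x
  colour-onto zero          = (zero , false) , refl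
  colour-onto (suc zero)    = (zero , true) , refl
  colour-onto (suc (suc x)) = outer (inject≤ (suc x) s≤n) , cong (proj₂ ∘ pairColours) (code-small (suc x))

  colouring : Coloring (StarCorona (suc n)) (suc (suc t))
  colouring = record { col = colour ; proper = λ _ _ → colour-proper ; onto = colour-onto }

  colouring-pairsInjective : PairsInjective colouring
  colouring-pairsInjective i j inners≡ outers≡ = code-injective (pairColours-injective (begin
    pairColours (code i)                ≡⟨ colour-pair i ⟨
    colour (inner i) , colour (outer i) ≡⟨ cong₂ _,_ inners≡ outers≡ ⟩
    colour (inner j) , colour (outer j) ≡⟨ colour-pair j ⟩
    pairColours (code j)                ∎))
    where open ≡-Reasoning

theorem8 : ∀ (n : ℕ) → 4 ≤ n → ∀ (s : ℕ) → CeilSqrt n s →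
    LocChromNum (StarCorona n) (suc s)
theorem8 zero    () _ _
theorem8 (suc n) _  zero    (() , _)
theorem8 (suc n) _  (suc t) (n≤s² , minimal) =
  (colouring , pairsInjective⇒locating colouring colouring-pairsInjective) , fewer
  where
  open Construction n≤s² (minimal (suc n) (ℕₚ.m≤m*n (suc n) (suc n)))
  fewer : ∀ k → k < suc (suc t) → ¬ HasLocatingColoring (StarCorona (suc n)) k
  fewer zero    _         (c , _)   = Finₚ.¬Fin0 (col c centre)
  fewer (suc k) (s≤s k<s) (c , loc) =
    ℕₚ.<⇒≱ k<s (minimal k (pairsInjective⇒bound c (locating⇒pairsInjective c loc)))
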